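{- For $A$-models $M_0,M_1$, an $A$-formula $\varphi$, an $A$-condition $\Gamma$, and $a<A$, we have $$\mathrm{Sub}(\varphi,M_0\oplus_aM_1,\Gamma)=\mathrm{Sub}\big(\varphi,M_0,\Gamma\cup^a\mathrm{Sub}(\varphi,M_1,\Gamma)\big)\cup\mathrm{Sub}(\varphi,M_1,\Gamma).$$
   Context: $A\le\omega$. $A$-formulas: from variables by $\bot,\to$, $\Diamond_c$ ($c<A$); $A$-models are Kripke models $(W,(R_c)_{c<A},\theta)$. A condition is a sequence $\Gamma=(\Gamma_c)_{c<A}$ of sets of $A$-formulas. Conditional truth $M,w\models^\Gamma\psi$ is defined like ordinary truth except $M,w\models^\Gamma\Diamond_c\psi$ iff $\psi\in\Gamma_c$ or $M,v\models^\Gamma\psi$ for some $v$ with $wR_cv$. $\mathrm{Sub}(\varphi,M,\Gamma)$ denotes the set of subformulas $\psi$ of $\varphi$ such that $M,v\models^\Gamma\psi$ for some $v$. For a set $\Psi$ of formulas, $\Gamma\cup^a\Psi$ is the condition $\Gamma'$ with $\Gamma'_a=\Gamma_a\cup\Psi$ and $\Gamma'_c=\Gamma_c$ for $c\neq a$. $M_0\oplus_aM_1$ is the disjoint union of $M_0$ and $M_1$ (domain $\{(i,w):i<2,w\in M_i\}$, valuation inherited componentwise) with all pairs $((0,w),(1,v))$ added to the $a$-th relation. -}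

module Defs where

open import Data.Nat using (ℕ)
open import Data.Fin using (Fin)
open import Data.Empty using (⊥)
open import Data.Sum using (_⊎_; inj₁; inj₂)
open import Data.Product using (Σ; ∃; _×_)
open import Relation.Binary.PropositionalEquality using (_≡_)
open import Function.Bundles using (_⇔_)

-- A ≤ ω : either a finite number n, or ω
data Card : Set where
  fin   : ℕ → Card
  omega : Card

Idx : Card → Set
Idx (fin n) = Fin n
Idx omega   = ℕ

data Form (A : Card) : Set where
  var  : ℕ → Form A
  bot  : Form A
  _⇒_  : Form A → Form A → Form A
  ◇    : Idx A → Form A → Form A

data _≼_ {A : Card} : Form A → Form A → Set where
  ≼-refl : ∀ {φ} → φ ≼ φ
  ≼-impL : ∀ {ψ φ χ} → ψ ≼ φ → ψ ≼ (φ ⇒ χ)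
  ≼-impR : ∀ {ψ φ χ} → ψ ≼ χ → ψ ≼ (φ ⇒ χ)
  ≼-dia  : ∀ {ψ φ c} → ψ ≼ φ → ψ ≼ ◇ c φ

record Model (A : Card) : Set₁ where
  field
    W : Set
    R : Idx A → W → W → Set
    θ : W → ℕ → Set
open Model public

FSet : Card → Set₁
FSet A = Form A → Set

Condition : Card → Set₁
Condition A = Idx A → FSet A

_,_⊨[_]_ : ∀ {A} (M : Model A) → W M → Condition A → Form A → Set
M , w ⊨[ Γ ] var p   = θ M w p
M , w ⊨[ Γ ] bot     = ⊥
M , w ⊨[ Γ ] (φ ⇒ ψ) = M , w ⊨[ Γ ] φ → M , w ⊨[ Γ ] ψ
M , w ⊨[ Γ ] ◇ c ψ   = Γ c ψ ⊎ Σ (W M) (λ v → R M c w v × M , v ⊨[ Γ ] ψ)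

Sub : ∀ {A} → Form A → Model A → Condition A → FSet A
Sub φ M Γ ψ = ψ ≼ φ × Σ (W M) (λ v → M , v ⊨[ Γ ] ψ)

_∪^[_]_ : ∀ {A} → Condition A → Idx A → FSet A → Condition A
(Γ ∪^[ a ] Ψ) c ψ = Γ c ψ ⊎ (c ≡ a × Ψ ψ)

_∪_ : ∀ {A} → FSet A → FSet A → FSet A
(X ∪ Y) ψ = X ψ ⊎ Y ψ

_≐_ : ∀ {A} → FSet A → FSet A → Set
X ≐ Y = ∀ ψ → X ψ ⇔ Y ψ

relSum : ∀ {A} (M₀ M₁ : Model A) (a : Idx A) → Idx A → (W M₀ ⊎ W M₁) → (W M₀ ⊎ W M₁) → Set
relSum M₀ M₁ a c (inj₁ w) (inj₁ v) = R M₀ c w v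
relSum M₀ M₁ a c (inj₁ w) (inj₂ v) = c ≡ a
relSum M₀ M₁ a c (inj₂ w) (inj₁ v) = ⊥
relSum M₀ M₁ a c (inj₂ w) (inj₂ v) = R M₁ c w v

valSum : ∀ {A} (M₀ M₁ : Model A) → (W M₀ ⊎ W M₁) → ℕ → Set
valSum M₀ M₁ (inj₁ w) = θ M₀ w
valSum M₀ M₁ (inj₂ w) = θ M₁ w

_⊕[_]_ : ∀ {A} → Model A → Idx A → Model A → Model A
M₀ ⊕[ a ] M₁ = record { W = W M₀ ⊎ W M₁ ; R = relSum M₀ M₁ a ; θ = valSum M₀ M₁ }

module Submission where

open import Defs
open import Data.Sum using (inj₁; inj₂)
open import Data.Product using (_,_)
open import Function.Bundles using (_⇔_; mk⇔; Equivalence)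
open import Function.Construct.Identity using (⇔-id)
open import Function.Related.TypeIsomorphisms using (→-cong-⇔)

open Equivalence using (to; from)

-- Proof idea: no world of M₁ sees M₀ in M₀ ⊕ₐ M₁, so truth at a world of M₁
-- is unchanged.  From a world of M₀ the only new accessible worlds are the
-- whole of M₁ along Rₐ, so ◇ₐ ψ additionally holds there exactly when ψ is
-- true somewhere in M₁; for subformulas of φ this is recorded by adding
-- Sub(φ, M₁, Γ) to the a-th component of the condition.

≼-trans : ∀ {A} {χ ψ φ : Form A} → χ ≼ ψ → ψ ≼ φ → χ ≼ φ
≼-trans p ≼-refl     = p
≼-trans p (≼-impL q) = ≼-impL (≼-trans p q)
≼-trans p (≼-impR q) = ≼-impR (≼-trans p q)
≼-trans p (≼-dia q)  = ≼-dia (≼-trans p q)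

≼-⇒ˡ : ∀ {A} {χ ψ φ : Form A} → (χ ⇒ ψ) ≼ φ → χ ≼ φ
≼-⇒ˡ = ≼-trans (≼-impL ≼-refl)

≼-⇒ʳ : ∀ {A} {χ ψ φ : Form A} → (χ ⇒ ψ) ≼ φ → ψ ≼ φ
≼-⇒ʳ = ≼-trans (≼-impR ≼-refl)

≼-◇ : ∀ {A} {c} {ψ φ : Form A} → ◇ c ψ ≼ φ → ψ ≼ φ
≼-◇ = ≼-trans (≼-dia ≼-refl)

module _ {A : Card} (M₀ M₁ : Model A) (a : Idx A) (Γ : Condition A) where

  ⊕-inj₂-⊨ : ∀ ψ w → (M₀ ⊕[ a ] M₁) , inj₂ w ⊨[ Γ ] ψ ⇔ M₁ , w ⊨[ Γ ] ψ
  ⊕-inj₂-⊨ (var p) w = ⇔-id _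
  ⊕-inj₂-⊨ bot     w = ⇔-id _
  ⊕-inj₂-⊨ (χ ⇒ ψ) w = →-cong-⇔ (⊕-inj₂-⊨ χ w) (⊕-inj₂-⊨ ψ w)
  ⊕-inj₂-⊨ (◇ c ψ) w = mk⇔ forth back
    where
    forth : (M₀ ⊕[ a ] M₁) , inj₂ w ⊨[ Γ ] ◇ c ψ → M₁ , w ⊨[ Γ ] ◇ c ψ
    forth (inj₁ γ)                = inj₁ γ
    forth (inj₂ (inj₁ v , () , _))
    forth (inj₂ (inj₂ v , r , t)) = inj₂ (v , r , to (⊕-inj₂-⊨ ψ v) t)

    back : M₁ , w ⊨[ Γ ] ◇ c ψ → (M₀ ⊕[ a ] M₁) , inj₂ w ⊨[ Γ ] ◇ c ψ
    back (inj₁ γ)           = inj₁ γ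
    back (inj₂ (v , r , t)) = inj₂ (inj₂ v , r , from (⊕-inj₂-⊨ ψ v) t)

  ⊕-inj₁-⊨ : ∀ {φ} ψ → ψ ≼ φ → ∀ w →
    (M₀ ⊕[ a ] M₁) , inj₁ w ⊨[ Γ ] ψ ⇔ M₀ , w ⊨[ Γ ∪^[ a ] Sub φ M₁ Γ ] ψ
  ⊕-inj₁-⊨ (var p) s w = ⇔-id _
  ⊕-inj₁-⊨ bot     s w = ⇔-id _
  ⊕-inj₁-⊨ (χ ⇒ ψ) s w =
    →-cong-⇔ (⊕-inj₁-⊨ χ (≼-⇒ˡ s) w) (⊕-inj₁-⊨ ψ (≼-⇒ʳ s) w)
  ⊕-inj₁-⊨ {φ} (◇ c ψ) s w = mk⇔ forth back
    where
    Γ′ = Γ ∪^[ a ] Sub φ M₁ Γ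

    forth : (M₀ ⊕[ a ] M₁) , inj₁ w ⊨[ Γ ] ◇ c ψ → M₀ , w ⊨[ Γ′ ] ◇ c ψ
    forth (inj₁ γ)                = inj₁ (inj₁ γ)
    forth (inj₂ (inj₁ v , r , t)) = inj₂ (v , r , to (⊕-inj₁-⊨ ψ (≼-◇ s) v) t)
    forth (inj₂ (inj₂ v , c≡a , t)) =
      inj₁ (inj₂ (c≡a , ≼-◇ s , v , to (⊕-inj₂-⊨ ψ v) t))

    back : M₀ , w ⊨[ Γ′ ] ◇ c ψ → (M₀ ⊕[ a ] M₁) , inj₁ w ⊨[ Γ ] ◇ c ψ
    back (inj₁ (inj₁ γ))                 = inj₁ γ
    back (inj₁ (inj₂ (c≡a , _ , v , t))) = inj₂ (inj₂ v , c≡a , from (⊕-inj₂-⊨ ψ v) t)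
    back (inj₂ (v , r , t)) = inj₂ (inj₁ v , r , from (⊕-inj₁-⊨ ψ (≼-◇ s) v) t)

lemma3p15 : ∀ {A : Card} (M₀ M₁ : Model A) (φ : Form A) (Γ : Condition A) (a : Idx A) →
    Sub φ (M₀ ⊕[ a ] M₁) Γ ≐ (Sub φ M₀ (Γ ∪^[ a ] Sub φ M₁ Γ) ∪ Sub φ M₁ Γ)
lemma3p15 M₀ M₁ φ Γ a ψ = mk⇔ forth back
  where
  forth : Sub φ (M₀ ⊕[ a ] M₁) Γ ψ → (Sub φ M₀ (Γ ∪^[ a ] Sub φ M₁ Γ) ∪ Sub φ M₁ Γ) ψ
  forth (s , inj₁ w , t) = inj₁ (s , w , to (⊕-inj₁-⊨ M₀ M₁ a Γ ψ s w) t)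
  forth (s , inj₂ w , t) = inj₂ (s , w , to (⊕-inj₂-⊨ M₀ M₁ a Γ ψ w) t)

  back : (Sub φ M₀ (Γ ∪^[ a ] Sub φ M₁ Γ) ∪ Sub φ M₁ Γ) ψ → Sub φ (M₀ ⊕[ a ] M₁) Γ ψ
  back (inj₁ (s , w , t)) = s , inj₁ w , from (⊕-inj₁-⊨ M₀ M₁ a Γ ψ s w) t
  back (inj₂ (s , w , t)) = s , inj₂ w , from (⊕-inj₂-⊨ M₀ M₁ a Γ ψ w) t
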